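{- Let $G_0=(V_0,E_0)$ be a semisimple graph, $\mathcal{M}$ a matroid on $E_0$ with rank function $r$, $G=(V,E)$ a subgraph of $G_0$ with $n=|V|$, and $d\ge 2$. Suppose that $\mathcal{M}$ has the $d$-dimensional $0$-extension property and that $\mathcal{M}$ has rank at most $dn$. Let $t\ge 0$ be an integer and let $X_0\subseteq X_1\subseteq\dots\subseteq X_t=V$ be such that for all $1\le i\le t$ and all $v\in X_i-X_{i-1}$ we have $|N_G(v)\cap X_{i-1}|\ge d$. Then $G$ has an $\mathcal{M}$-seed $K$ with \[|K|\le 2|X_0|\frac{d^{t+1}}{d-1}.\]
   Context: A semisimple graph has no parallel edges and at most one loop at each vertex. For a subgraph $H$ write $r(H)$ for the rank of its edge set. A subgraph $H$ is $\mathcal{M}$-independent if $r(E(H))=|E(H)|$. $N_G(x)$ is the set of vertices adjacent to $x$ in $G$ (including $x$ if there is a loop at $x$). A $d$-dimensional $0$-extension of a graph $H$ adds a new vertex $v$ and joins $v$ to $d$ distinct vertices of $V(H)+v$ (joining $v$ to itself means adding the loop $vv$). $\mathcal{M}$ has the $d$-dimensional $0$-extension property if whenever $G_1,G_2$ are subgraphs of $G_0$, $G_1$ is $\mathcal{M}$-independent and $G_2$ is a $d$-dimensional $0$-extension of $G_1$, then $G_2$ is $\mathcal{M}$-independent. A subset $K\subseteq V$ is an $\mathcal{M}$-seed of $G$ (with respect to $d$) if (i) $r(G)=r(G[K])+d|V-K|$, and (ii) for every $K'$ with $K\subseteq K'\subsetneq V$ there is $x\in V-K'$ with $|(K'+x)\cap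 N_G(x)|\ge d$. -}

module Defs where

-- The ambient semisimple graph G₀ = (V₀,E₀) has vertex set Fin m and edge
-- set Fin e; edge f has (unordered) endpoints given by  ends f  (a pair
-- (u , u) encodes a loop at u).

open import Data.Nat using (ℕ; _+_; _*_; _≤_)
open import Data.Fin using (Fin)
open import Data.Fin.Properties using (any?)
open import Data.Fin.Subset
open import Data.Fin.Subset.Properties using (_∈?_)
open import Data.Product using (Σ; ∃; _×_; _,_; proj₁; proj₂)
open import Data.Product.Properties using (≡-dec)
open import Data.Sum using (_⊎_)
open import Data.Vec using (tabulate)
open import Relation.Nullary using (Dec; ¬_)
open import Relation.Nullary.Decidable using (⌊_⌋; _×-dec_; _⊎-dec_)
open import Relation.Binary.PropositionalEquality using (_≡_)
import Data.Fin as F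

module _ {m e : ℕ} (ends : Fin e → Fin m × Fin m) where

  Joins : Fin e → Fin m → Fin m → Set
  Joins f u w = (ends f ≡ (u , w)) ⊎ (ends f ≡ (w , u))

  joins? : ∀ f u w → Dec (Joins f u w)
  joins? f u w = ≡-dec F._≟_ F._≟_ (ends f) (u , w)
           ⊎-dec ≡-dec F._≟_ F._≟_ (ends f) (w , u)

  Semisimple : Set
  Semisimple = ∀ f g u w → Joins f u w → Joins g u w → f ≡ g

  IsSubgraph : Subset m → Subset e → Set
  IsSubgraph VH EH = ∀ f → f ∈ EH → proj₁ (ends f) ∈ VH × proj₂ (ends f) ∈ VH

  -- N_G(x) for the graph with edge set E (contains x iff a loop at x lies in E)
  nbhd : Subset e → Fin m → Subset m
  nbhd E x = tabulate (λ y → ⌊ any? (λ f → (f ∈? E) ×-dec joins? f x y) ⌋)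

  induced : Subset e → Subset m → Subset e
  induced E K = tabulate (λ f → ⌊ (f ∈? E) ×-dec ((proj₁ (ends f) ∈? K) ×-dec (proj₂ (ends f) ∈? K)) ⌋)

  IsZeroExtension : ℕ → Subset m → Subset e → Subset m → Subset e → Set
  IsZeroExtension d V₁ E₁ V₂ E₂ =
    Σ (Fin m) λ v → v ∉ V₁ × V₂ ≡ V₁ ∪ ⁅ v ⁆ ×
    Σ (Subset e) λ D → ∣ D ∣ ≡ d ×
      (∀ f → f ∈ D → Σ (Fin m) λ w → w ∈ V₂ × Joins f v w) ×
      E₂ ≡ E₁ ∪ D

module _ {e : ℕ} where

  record IsMatroidRank (r : Subset e → ℕ) : Set where
    field
      r-bounded   : ∀ X → r X ≤ ∣ X ∣
      r-monotone  : ∀ X Y → X ⊆ Y → r X ≤ r Y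
      r-submod    : ∀ X Y → r (X ∪ Y) + r (X ∩ Y) ≤ r X + r Y

  Independent : (Subset e → ℕ) → Subset e → Set
  Independent r E = r E ≡ ∣ E ∣

module _ {m e : ℕ} (ends : Fin e → Fin m × Fin m) (r : Subset e → ℕ) where

  ZeroExtensionProperty : ℕ → Set
  ZeroExtensionProperty d =
    ∀ V₁ E₁ V₂ E₂ → IsSubgraph ends V₁ E₁ → IsSubgraph ends V₂ E₂ →
    Independent r E₁ → IsZeroExtension ends d V₁ E₁ V₂ E₂ → Independent r E₂

  IsSeed : ℕ → Subset m → Subset e → Subset m → Set
  IsSeed d V E K =
    K ⊆ V ×
    r E ≡ r (induced ends E K) + d * ∣ V ─ K ∣ ×
    (∀ K′ → K ⊆ K′ → K′ ⊂ V →
       Σ (Fin m) λ x → x ∈ V × x ∉ K′ × d ≤ ∣ (K′ ∪ ⁅ x ⁆) ∩ nbhd ends E x ∣)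

-- For each vertex v of V − X₀ entering the filtration at step i + 1, fix a set  down v  of d
-- edges joining v to X i.  Adding the vertices of V − X₀ layer by layer, each with its down-edges,
-- is a sequence of d-dimensional 0-extensions, so F₀ = ⋃ down is independent of size d|V − X₀|.
-- Extend F₀ to a basis of E; since r(M) ≤ d|V|, at most d|X₀| basis edges lie outside F₀.  Let K
-- be X₀ together with every vertex reachable from an endpoint of these surplus edges along
-- down-edges; one vertex reaches at most 1 + d + … + d^(t−1) vertices, which gives the bound.
-- K is closed under down-edges, so every basis edge lies in G[K] or in  down v  for some v ∉ K,
-- whence r(E) ≤ r(G[K]) + d|V − K|; conversely a basis of G[K] extended by the down-edges of
-- V − K is again built by 0-extensions, which gives equality.  Condition (ii) holds for every
-- K ⊇ X₀: the lowest layer not contained in K′ has a vertex outside K′ with d neighbours in the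
-- layer below.

module Submission where

open import Defs
open import Data.Nat using (ℕ; zero; suc; _+_; _*_; _∸_; _^_; _⊓_; _≤_; _<_; _≤′_; ≤′-refl; ≤′-step; z≤n; s≤s; _≟_; _≤?_)
open import Data.Nat.Properties
open import Data.Nat.Tactic.RingSolver using (solve-∀)
open import Data.Fin using (Fin; zero; suc; toℕ; fromℕ<)
import Data.Fin as Fin
open import Data.Fin.Properties using (any?; toℕ<n; toℕ-fromℕ<)
open import Data.Fin.Subset
open import Data.Fin.Subset.Properties
open import Data.Fin.Subset.Induction using (Acc; acc; ⊂-wellFounded; ⊃-wellFounded)
open import Data.Bool using (true; false)
open import Data.Vec using ([]; _∷_; tabulate; here; there)
open import Data.Vec.Properties using (lookup∘tabulate; []=⇒lookup; lookup⇒[]=)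
open import Data.Product using (Σ; ∃; _×_; _,_; proj₁; proj₂; map₂; uncurry)
open import Data.Sum using (_⊎_; inj₁; inj₂; [_,_]′) renaming (map to ⊎-map)
open import Data.Empty using (⊥-elim)
open import Function using (_∘_)
open import Relation.Nullary using (Dec; yes; no; ¬?)
open import Relation.Nullary.Decidable using (⌊_⌋; _×-dec_)
open import Relation.Unary using (Decidable)
open import Relation.Binary.PropositionalEquality

private variable
  n : ℕ
  p q s : Subset n
  x : Fin n

Disjoint : Subset n → Subset n → Set
Disjoint p q = ∀ {x} → x ∈ p → x ∉ q

module _ {P : Fin n → Set} (P? : Decidable P) where

  ∈-tabulate⁺ : P x → x ∈ tabulate (⌊_⌋ ∘ P?)
  ∈-tabulate⁺ {x} px = lookup⇒[]= x _ (trans (lookup∘tabulate _ x) (holds (P? x)))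
    where
    holds : (dec : Dec (P x)) → ⌊ dec ⌋ ≡ true
    holds (yes _) = refl
    holds (no ¬px) = ⊥-elim (¬px px)

  ∈-tabulate⁻ : x ∈ tabulate (⌊_⌋ ∘ P?) → P x
  ∈-tabulate⁻ {x} x∈ = holds (P? x) (trans (sym (lookup∘tabulate _ x)) ([]=⇒lookup x∈))
    where
    holds : (dec : Dec (P x)) → ⌊ dec ⌋ ≡ true → P x
    holds (yes px) _ = px

x∈p─q⁻ : ∀ (p q : Subset n) → x ∈ p ─ q → x ∈ p × x ∉ q
x∈p─q⁻ p q x∈ = p─q⊆p p q x∈ , x∉q p q x∈
  where
  x∉q : ∀ (p q : Subset n) → x ∈ p ─ q → x ∉ q
  x∉q (true ∷ p) (false ∷ q) here ()
  x∉q (_ ∷ p) (_ ∷ q) (there x∈) (there x∈q) = x∉q p q x∈ x∈q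

x∈p⇒⁅x⁆⊆p : x ∈ p → ⁅ x ⁆ ⊆ p
x∈p⇒⁅x⁆⊆p {x = x} {p} x∈p y∈ = subst (_∈ p) (sym (x∈⁅y⁆⇒x≡y x y∈)) x∈p

∪-least : p ⊆ s → q ⊆ s → p ∪ q ⊆ s
∪-least {p = p} {q = q} p⊆s q⊆s x∈ = [ p⊆s , q⊆s ]′ (x∈p∪q⁻ p q x∈)

∣p∪q∣+∣p∩q∣≡∣p∣+∣q∣ : ∀ (p q : Subset n) → ∣ p ∪ q ∣ + ∣ p ∩ q ∣ ≡ ∣ p ∣ + ∣ q ∣
∣p∪q∣+∣p∩q∣≡∣p∣+∣q∣ [] [] = refl
∣p∪q∣+∣p∩q∣≡∣p∣+∣q∣ (true ∷ p) (true ∷ q) =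
  cong suc (trans (+-suc _ _) (trans (cong suc (∣p∪q∣+∣p∩q∣≡∣p∣+∣q∣ p q)) (sym (+-suc _ _))))
∣p∪q∣+∣p∩q∣≡∣p∣+∣q∣ (true ∷ p) (false ∷ q) = cong suc (∣p∪q∣+∣p∩q∣≡∣p∣+∣q∣ p q)
∣p∪q∣+∣p∩q∣≡∣p∣+∣q∣ (false ∷ p) (true ∷ q) = trans (cong suc (∣p∪q∣+∣p∩q∣≡∣p∣+∣q∣ p q)) (sym (+-suc _ _))
∣p∪q∣+∣p∩q∣≡∣p∣+∣q∣ (false ∷ p) (false ∷ q) = ∣p∪q∣+∣p∩q∣≡∣p∣+∣q∣ p q

∣p∪q∣≤∣p∣+∣q∣ : ∀ (p q : Subset n) → ∣ p ∪ q ∣ ≤ ∣ p ∣ + ∣ q ∣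
∣p∪q∣≤∣p∣+∣q∣ p q = ≤-trans (m≤m+n _ _) (≤-reflexive (∣p∪q∣+∣p∩q∣≡∣p∣+∣q∣ p q))

disjoint⇒∣p∪q∣≡∣p∣+∣q∣ : ∀ (p q : Subset n) → Disjoint p q → ∣ p ∪ q ∣ ≡ ∣ p ∣ + ∣ q ∣
disjoint⇒∣p∪q∣≡∣p∣+∣q∣ {n} p q p#q = begin
  ∣ p ∪ q ∣                 ≡⟨ +-identityʳ _ ⟨
  ∣ p ∪ q ∣ + 0             ≡⟨ cong (∣ p ∪ q ∣ +_) (∣⊥∣≡0 n) ⟨
  ∣ p ∪ q ∣ + ∣ ⊥ {n} ∣     ≡⟨ cong (λ s → ∣ p ∪ q ∣ + ∣ s ∣) (Empty-unique λ (_ , x∈) → uncurry p#q (x∈p∩q⁻ p q x∈)) ⟨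
  ∣ p ∪ q ∣ + ∣ p ∩ q ∣     ≡⟨ ∣p∪q∣+∣p∩q∣≡∣p∣+∣q∣ p q ⟩
  ∣ p ∣ + ∣ q ∣             ∎
  where open ≡-Reasoning

p⊆q∪[p─q] : ∀ (p q : Subset n) → p ⊆ q ∪ (p ─ q)
p⊆q∪[p─q] p q {x} x∈p with x ∈? q
... | yes x∈q = x∈p∪q⁺ (inj₁ x∈q)
... | no  x∉q = x∈p∪q⁺ (inj₂ (x∈p∧x∉q⇒x∈p─q x∈p x∉q))

∣p∣≡∣q∣+∣p─q∣ : ∀ (p q : Subset n) → q ⊆ p → ∣ p ∣ ≡ ∣ q ∣ + ∣ p ─ q ∣
∣p∣≡∣q∣+∣p─q∣ p q q⊆p = begin
  ∣ p ∣               ≡⟨ cong ∣_∣ (⊆-antisym (p⊆q∪[p─q] p q) (∪-least q⊆p (p─q⊆p p q))) ⟩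
  ∣ q ∪ (p ─ q) ∣     ≡⟨ disjoint⇒∣p∪q∣≡∣p∣+∣q∣ q (p ─ q) (λ x∈q x∈p─q → proj₂ (x∈p─q⁻ p q x∈p─q) x∈q) ⟩
  ∣ q ∣ + ∣ p ─ q ∣   ∎
  where open ≡-Reasoning

x∈p⇒∣p∣≡1+∣p-x∣ : x ∈ p → ∣ p ∣ ≡ suc ∣ p - x ∣
x∈p⇒∣p∣≡1+∣p-x∣ {x = x} {p} x∈p =
  trans (∣p∣≡∣q∣+∣p─q∣ p ⁅ x ⁆ (x∈p⇒⁅x⁆⊆p x∈p)) (cong (_+ ∣ p - x ∣) (∣⁅x⁆∣≡1 x))

x∈p⇒p-x∪⁅x⁆≡p : x ∈ p → (p - x) ∪ ⁅ x ⁆ ≡ p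
x∈p⇒p-x∪⁅x⁆≡p {x = x} {p} x∈p = ⊆-antisym (∪-least (p─q⊆p p ⁅ x ⁆) (x∈p⇒⁅x⁆⊆p x∈p)) p⊆
  where
  p⊆ : p ⊆ (p - x) ∪ ⁅ x ⁆
  p⊆ {y} y∈p with y Fin.≟ x
  ... | yes refl = x∈p∪q⁺ (inj₂ (x∈⁅x⁆ y))
  ... | no  y≢x  = x∈p∪q⁺ (inj₁ (x∈p∧x≢y⇒x∈p-y y∈p y≢x))

⋃[_]_ : ∀ {m} → Subset n → (Fin n → Subset m) → Subset m
⋃[ [] ]        g = ⊥
⋃[ true ∷ p ]  g = g zero ∪ ⋃[ p ] (g ∘ suc)
⋃[ false ∷ p ] g = ⋃[ p ] (g ∘ suc)

module _ {m : ℕ} where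

  x∈⋃⁺ : ∀ (p : Subset n) (g : Fin n → Subset m) {i y} → i ∈ p → y ∈ g i → y ∈ ⋃[ p ] g
  x∈⋃⁺ (true ∷ p)  g here       y∈ = x∈p∪q⁺ (inj₁ y∈)
  x∈⋃⁺ (true ∷ p)  g (there i∈) y∈ = x∈p∪q⁺ (inj₂ (x∈⋃⁺ p (g ∘ suc) i∈ y∈))
  x∈⋃⁺ (false ∷ p) g (there i∈) y∈ = x∈⋃⁺ p (g ∘ suc) i∈ y∈

  x∈⋃⁻ : ∀ (p : Subset n) (g : Fin n → Subset m) {y} → y ∈ ⋃[ p ] g → ∃ λ i → i ∈ p × y ∈ g i
  x∈⋃⁻ [] g y∈ = ⊥-elim (∉⊥ y∈)
  x∈⋃⁻ (true ∷ p) g y∈ with x∈p∪q⁻ (g zero) _ y∈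
  ... | inj₁ y∈g0 = zero , here , y∈g0
  ... | inj₂ y∈⋃ = let i , i∈ , y∈gi = x∈⋃⁻ p (g ∘ suc) y∈⋃ in suc i , there i∈ , y∈gi
  x∈⋃⁻ (false ∷ p) g y∈ = let i , i∈ , y∈gi = x∈⋃⁻ p (g ∘ suc) y∈ in suc i , there i∈ , y∈gi

  ∣⋃∣≤∣p∣*c : ∀ (p : Subset n) (g : Fin n → Subset m) c → (∀ {i} → i ∈ p → ∣ g i ∣ ≤ c) →
              ∣ ⋃[ p ] g ∣ ≤ ∣ p ∣ * c
  ∣⋃∣≤∣p∣*c []          g c bound = ≤-reflexive (∣⊥∣≡0 m)
  ∣⋃∣≤∣p∣*c (true ∷ p)  g c bound = ≤-trans (∣p∪q∣≤∣p∣+∣q∣ (g zero) _)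
    (+-mono-≤ (bound here) (∣⋃∣≤∣p∣*c p (g ∘ suc) c (bound ∘ there)))
  ∣⋃∣≤∣p∣*c (false ∷ p) g c bound = ∣⋃∣≤∣p∣*c p (g ∘ suc) c (bound ∘ there)

  ⋃-∪ : ∀ (p q : Subset n) (g : Fin n → Subset m) → ⋃[ p ∪ q ] g ≡ ⋃[ p ] g ∪ ⋃[ q ] g
  ⋃-∪ p q g = ⊆-antisym ⊆∪ ∪⊆
    where
    ⊆∪ : ⋃[ p ∪ q ] g ⊆ ⋃[ p ] g ∪ ⋃[ q ] g
    ⊆∪ y∈ with x∈⋃⁻ (p ∪ q) g y∈
    ... | i , i∈ , y∈gi = x∈p∪q⁺ (⊎-map (λ i∈p → x∈⋃⁺ p g i∈p y∈gi) (λ i∈q → x∈⋃⁺ q g i∈q y∈gi) (x∈p∪q⁻ p q i∈))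
    ∪⊆ : ⋃[ p ] g ∪ ⋃[ q ] g ⊆ ⋃[ p ∪ q ] g
    ∪⊆ y∈ with x∈p∪q⁻ (⋃[ p ] g) _ y∈
    ... | inj₁ y∈p = let i , i∈ , y∈gi = x∈⋃⁻ p g y∈p in x∈⋃⁺ (p ∪ q) g (x∈p∪q⁺ (inj₁ i∈)) y∈gi
    ... | inj₂ y∈q = let i , i∈ , y∈gi = x∈⋃⁻ q g y∈q in x∈⋃⁺ (p ∪ q) g (x∈p∪q⁺ (inj₂ i∈)) y∈gi

  ⋃-⁅⁆ : ∀ (i : Fin n) (g : Fin n → Subset m) → ⋃[ ⁅ i ⁆ ] g ≡ g i
  ⋃-⁅⁆ i g = ⊆-antisym ⊆gi (x∈⋃⁺ ⁅ i ⁆ g (x∈⁅x⁆ i))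
    where
    ⊆gi : ⋃[ ⁅ i ⁆ ] g ⊆ g i
    ⊆gi y∈ with x∈⋃⁻ ⁅ i ⁆ g y∈
    ... | j , j∈ , y∈gj = subst (λ k → _ ∈ g k) (x∈⁅y⁆⇒x≡y i j∈) y∈gj

  ⋃-⊥ : ∀ (g : Fin n → Subset m) → ⋃[ ⊥ ] g ≡ ⊥
  ⋃-⊥ g = Empty-unique λ (_ , y∈) → let _ , i∈⊥ , _ = x∈⋃⁻ ⊥ g y∈ in ∉⊥ i∈⊥

  ⋃-least : ∀ (p : Subset n) {g : Fin n → Subset m} {q} → (∀ {i} → i ∈ p → g i ⊆ q) → ⋃[ p ] g ⊆ q
  ⋃-least p {g} g⊆q y∈ = let i , i∈ , y∈gi = x∈⋃⁻ p g y∈ in g⊆q i∈ y∈gi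

prefix : ℕ → Subset n → Subset n
prefix k       []          = []
prefix zero    (_ ∷ p)     = outside ∷ prefix zero p
prefix (suc k) (true ∷ p)  = inside ∷ prefix k p
prefix (suc k) (false ∷ p) = outside ∷ prefix (suc k) p

prefix⊆ : ∀ k (p : Subset n) → prefix k p ⊆ p
prefix⊆ zero    (_ ∷ p)     (there x∈) = there (prefix⊆ zero p x∈)
prefix⊆ (suc k) (true ∷ p)  here       = here
prefix⊆ (suc k) (true ∷ p)  (there x∈) = there (prefix⊆ k p x∈)
prefix⊆ (suc k) (false ∷ p) (there x∈) = there (prefix⊆ (suc k) p x∈)

∣prefix∣≡k⊓∣p∣ : ∀ k (p : Subset n) → ∣ prefix k p ∣ ≡ k ⊓ ∣ p ∣
∣prefix∣≡k⊓∣p∣ k       []          = sym (⊓-zeroʳ k)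
∣prefix∣≡k⊓∣p∣ zero    (_ ∷ p)     = ∣prefix∣≡k⊓∣p∣ zero p
∣prefix∣≡k⊓∣p∣ (suc k) (true ∷ p)  = cong suc (∣prefix∣≡k⊓∣p∣ k p)
∣prefix∣≡k⊓∣p∣ (suc k) (false ∷ p) = ∣prefix∣≡k⊓∣p∣ (suc k) p

x∉p⇒∣p∪⁅x⁆∣≡1+∣p∣ : x ∉ p → ∣ p ∪ ⁅ x ⁆ ∣ ≡ suc ∣ p ∣
x∉p⇒∣p∪⁅x⁆∣≡1+∣p∣ {x = x} {p} x∉p = begin
  ∣ p ∪ ⁅ x ⁆ ∣     ≡⟨ disjoint⇒∣p∪q∣≡∣p∣+∣q∣ p ⁅ x ⁆ (λ y∈p y∈⁅x⁆ → x∉p (subst (_∈ p) (x∈⁅y⁆⇒x≡y x y∈⁅x⁆) y∈p)) ⟩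
  ∣ p ∣ + ∣ ⁅ x ⁆ ∣ ≡⟨ cong (∣ p ∣ +_) (∣⁅x⁆∣≡1 x) ⟩
  ∣ p ∣ + 1         ≡⟨ +-comm ∣ p ∣ 1 ⟩
  suc ∣ p ∣         ∎
  where open ≡-Reasoning

module MatroidRank {e : ℕ} {r : Subset e → ℕ} (isRank : IsMatroidRank r) where

  open IsMatroidRank isRank

  IsBasis : Subset e → Subset e → Set
  IsBasis A B = B ⊆ A × Independent r B × r A ≤ r B

  independent-⊥ : Independent r ⊥
  independent-⊥ = ≤-antisym (r-bounded ⊥) (subst (_≤ r ⊥) (sym (∣⊥∣≡0 e)) z≤n)

  r-subadditive : ∀ A B → r (A ∪ B) ≤ r A + r B
  r-subadditive A B = ≤-trans (m≤m+n _ _) (r-submod A B)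

  r[B∪Y]≤r[B] : ∀ B Y → (∀ {y} → y ∈ Y → r (B ∪ ⁅ y ⁆) ≤ r B) → r (B ∪ Y) ≤ r B
  r[B∪Y]≤r[B] B Y = go Y (⊂-wellFounded Y)
    where
    go : ∀ Y → Acc _⊂_ Y → (∀ {y} → y ∈ Y → r (B ∪ ⁅ y ⁆) ≤ r B) → r (B ∪ Y) ≤ r B
    go Y (acc rec) spans with nonempty? Y
    ... | no Y-empty = ≤-reflexive (cong r (trans (cong (B ∪_) (Empty-unique Y-empty)) (∪-identityʳ B)))
    ... | yes (y , y∈Y) = +-cancelʳ-≤ (r B) _ _ (begin
      r (B ∪ Y) + r B                                  ≤⟨ +-mono-≤ (r-monotone _ _ ⊆∪) (r-monotone _ _ ⊆∩) ⟩
      r ((B ∪ Y′) ∪ (B ∪ ⁅ y ⁆)) + r ((B ∪ Y′) ∩ (B ∪ ⁅ y ⁆)) ≤⟨ r-submod (B ∪ Y′) (B ∪ ⁅ y ⁆) ⟩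
      r (B ∪ Y′) + r (B ∪ ⁅ y ⁆)                        ≤⟨ +-mono-≤ (go Y′ (rec (x∈p⇒p-x⊂p y∈Y)) (spans ∘ p─q⊆p Y ⁅ y ⁆)) (spans y∈Y) ⟩
      r B + r B                                        ∎)
      where
      open ≤-Reasoning
      Y′ = Y - y
      ⊆∪ : B ∪ Y ⊆ (B ∪ Y′) ∪ (B ∪ ⁅ y ⁆)
      ⊆∪ {x} x∈ with x∈p∪q⁻ B Y x∈ | x Fin.≟ y
      ... | inj₁ x∈B | _        = p⊆p∪q (B ∪ ⁅ y ⁆) (p⊆p∪q Y′ x∈B)
      ... | inj₂ _   | yes refl = q⊆p∪q (B ∪ Y′) _ (q⊆p∪q B ⁅ y ⁆ (x∈⁅x⁆ x))
      ... | inj₂ x∈Y | no x≢y   = p⊆p∪q (B ∪ ⁅ y ⁆) (q⊆p∪q B Y′ (x∈p∧x≢y⇒x∈p-y x∈Y x≢y))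
      ⊆∩ : B ⊆ (B ∪ Y′) ∩ (B ∪ ⁅ y ⁆)
      ⊆∩ x∈B = x∈p∩q⁺ (p⊆p∪q Y′ x∈B , p⊆p∪q ⁅ y ⁆ x∈B)

  basis-extension : ∀ A B → B ⊆ A → Independent r B → ∃ λ Bas → B ⊆ Bas × IsBasis A Bas
  basis-extension A B = go B (⊃-wellFounded B)
    where
    go : ∀ B → Acc _⊃_ B → B ⊆ A → Independent r B → ∃ λ Bas → B ⊆ Bas × IsBasis A Bas
    go B (acc rec) B⊆A indB
      with any? (λ x → (x ∈? A) ×-dec ¬? (x ∈? B) ×-dec (r (B ∪ ⁅ x ⁆) ≟ ∣ B ∪ ⁅ x ⁆ ∣))
    ... | yes (x , x∈A , x∉B , indB+x) =
      let Bas , B+x⊆Bas , basis = go (B ∪ ⁅ x ⁆) (rec B⊂B+x) (∪-least B⊆A (x∈p⇒⁅x⁆⊆p x∈A)) indB+x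
      in Bas , B+x⊆Bas ∘ p⊆p∪q ⁅ x ⁆ , basis
      where
      B⊂B+x : B ⊂ B ∪ ⁅ x ⁆
      B⊂B+x = p⊆p∪q ⁅ x ⁆ , x , q⊆p∪q B ⁅ x ⁆ (x∈⁅x⁆ x) , x∉B
    ... | no maximal = B , ⊆-refl , B⊆A , indB ,
      ≤-trans (r-monotone A (B ∪ A) (q⊆p∪q B A)) (r[B∪Y]≤r[B] B A no-gain)
      where
      no-gain : ∀ {x} → x ∈ A → r (B ∪ ⁅ x ⁆) ≤ r B
      no-gain {x} x∈A with x ∈? B
      ... | yes x∈B = r-monotone _ _ (∪-least ⊆-refl (x∈p⇒⁅x⁆⊆p x∈B))
      ... | no  x∉B = begin
        r (B ∪ ⁅ x ⁆) ≤⟨ ≤-pred (≤∧≢⇒< r≤1+∣B∣ (λ eq → maximal (x , x∈A , x∉B , trans eq (sym ∣B+x∣)))) ⟩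
        ∣ B ∣          ≡⟨ indB ⟨
        r B           ∎
        where
        open ≤-Reasoning
        ∣B+x∣ = x∉p⇒∣p∪⁅x⁆∣≡1+∣p∣ x∉B
        r≤1+∣B∣ : r (B ∪ ⁅ x ⁆) ≤ suc ∣ B ∣
        r≤1+∣B∣ = ≤-trans (r-bounded _) (≤-reflexive ∣B+x∣)

  basis-rank : ∀ {A B} → IsBasis A B → r A ≡ ∣ B ∣
  basis-rank (B⊆A , indB , rA≤rB) = ≤-antisym (≤-trans rA≤rB (≤-reflexive indB))
                                              (≤-trans (≤-reflexive (sym indB)) (r-monotone _ _ B⊆A))

geometric : ℕ → ℕ → ℕ
geometric d zero    = 0
geometric d (suc j) = suc (d * geometric d j)

geometric-closed : ∀ d′ j → d′ * geometric (suc d′) j + 1 ≡ suc d′ ^ j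
geometric-closed d′ zero    = cong (_+ 1) (*-zeroʳ d′)
geometric-closed d′ (suc j) = begin
  d′ * suc (suc d′ * g) + 1  ≡⟨ regroup d′ g ⟩
  suc d′ * (d′ * g + 1)      ≡⟨ cong (suc d′ *_) (geometric-closed d′ j) ⟩
  suc d′ * suc d′ ^ j        ∎
  where
  open ≡-Reasoning
  g = geometric (suc d′) j
  regroup : ∀ d′ g → d′ * suc (suc d′ * g) + 1 ≡ suc d′ * (d′ * g + 1)
  regroup = solve-∀

seed-size-arithmetic : ∀ d′ t a k → k ≤ a + suc d′ * a * 2 * geometric (suc d′) t →
                       d′ * k ≤ 2 * a * suc d′ ^ (t + 1)
seed-size-arithmetic d′ t a k k≤ = begin
  d′ * k                                      ≤⟨ *-monoʳ-≤ d′ k≤ ⟩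
  d′ * (a + D * a * 2 * g)                    ≡⟨ expand d′ a g ⟩
  d′ * a + 2 * D * a * (d′ * g)               ≤⟨ +-monoˡ-≤ _ (*-monoˡ-≤ a d′≤2D) ⟩
  2 * D * a + 2 * D * a * (d′ * g)            ≡⟨ cong (_+ 2 * D * a * (d′ * g)) (*-identityʳ (2 * D * a)) ⟨
  2 * D * a * 1 + 2 * D * a * (d′ * g)        ≡⟨ *-distribˡ-+ (2 * D * a) 1 (d′ * g) ⟨
  2 * D * a * (1 + d′ * g)                    ≡⟨ cong (2 * D * a *_) (trans (+-comm 1 _) (geometric-closed d′ t)) ⟩
  2 * D * a * D ^ t                           ≡⟨ collect D a (D ^ t) ⟩
  2 * a * D ^ suc t                           ≡⟨ cong (λ n → 2 * a * D ^ n) (+-comm 1 t) ⟩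
  2 * a * D ^ (t + 1)                         ∎
  where
  open ≤-Reasoning
  D = suc d′
  g = geometric D t
  d′≤2D : d′ ≤ 2 * D
  d′≤2D = ≤-trans (n≤1+n d′) (m≤m+n D _)
  expand : ∀ d′ a g → d′ * (a + suc d′ * a * 2 * g) ≡ d′ * a + 2 * suc d′ * a * (d′ * g)
  expand = solve-∀
  collect : ∀ D a p → 2 * D * a * p ≡ 2 * a * (D * p)
  collect = solve-∀

module Edges {m e : ℕ} (ends : Fin e → Fin m × Fin m) where

  opposite : Fin m → Fin e → Fin m
  opposite v f with proj₁ (ends f) Fin.≟ v
  ... | yes _ = proj₂ (ends f)
  ... | no  _ = proj₁ (ends f)

  Joins⇒opposite≡ : ∀ {f v w} → Joins ends f v w → opposite v f ≡ w
  Joins⇒opposite≡ {f} {v} j with proj₁ (ends f) Fin.≟ v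
  Joins⇒opposite≡ (inj₁ eq) | yes _   = cong proj₂ eq
  Joins⇒opposite≡ (inj₂ eq) | yes u≡v = trans (cong proj₂ eq) (trans (sym u≡v) (cong proj₁ eq))
  Joins⇒opposite≡ (inj₁ eq) | no  u≢v = ⊥-elim (u≢v (cong proj₁ eq))
  Joins⇒opposite≡ (inj₂ eq) | no  _   = cong proj₁ eq

  Joins⇒ends∈ : ∀ {f v w} {S : Subset m} → Joins ends f v w → v ∈ S → w ∈ S →
                proj₁ (ends f) ∈ S × proj₂ (ends f) ∈ S
  Joins⇒ends∈ (inj₁ eq) v∈ w∈ rewrite eq = v∈ , w∈
  Joins⇒ends∈ (inj₂ eq) v∈ w∈ rewrite eq = w∈ , v∈

  Joins⇒end≡ : ∀ {f v w} → Joins ends f v w → proj₁ (ends f) ≡ v ⊎ proj₂ (ends f) ≡ v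
  Joins⇒end≡ (inj₁ eq) = inj₁ (cong proj₁ eq)
  Joins⇒end≡ (inj₂ eq) = inj₂ (cong proj₂ eq)

  EdgeTo : Subset e → Fin m → Subset m → Fin e → Set
  EdgeTo E v W f = f ∈ E × ∃ λ w → w ∈ W × Joins ends f v w

  edgeTo? : ∀ E v W f → Dec (EdgeTo E v W f)
  edgeTo? E v W f = (f ∈? E) ×-dec any? (λ w → (w ∈? W) ×-dec joins? ends f v w)

  edgesTo : Subset e → Fin m → Subset m → Subset e
  edgesTo E v W = tabulate (⌊_⌋ ∘ edgeTo? E v W)

  ∣nbhd∩W∣≤∣edgesTo∣ : ∀ E v W → ∣ nbhd ends E v ∩ W ∣ ≤ ∣ edgesTo E v W ∣
  ∣nbhd∩W∣≤∣edgesTo∣ E v W = begin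
    ∣ nbhd ends E v ∩ W ∣                         ≤⟨ p⊆q⇒∣p∣≤∣q∣ covered ⟩
    ∣ ⋃[ edgesTo E v W ] (⁅_⁆ ∘ opposite v) ∣     ≤⟨ ∣⋃∣≤∣p∣*c (edgesTo E v W) (⁅_⁆ ∘ opposite v) 1 singletons ⟩
    ∣ edgesTo E v W ∣ * 1                         ≡⟨ *-identityʳ _ ⟩
    ∣ edgesTo E v W ∣                             ∎
    where
    open ≤-Reasoning
    singletons : ∀ {f} → f ∈ edgesTo E v W → ∣ ⁅ opposite v f ⁆ ∣ ≤ 1
    singletons {f} _ = ≤-reflexive (∣⁅x⁆∣≡1 (opposite v f))
    covered : nbhd ends E v ∩ W ⊆ ⋃[ edgesTo E v W ] (⁅_⁆ ∘ opposite v)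
    covered {w} w∈ =
      let w∈N , w∈W = x∈p∩q⁻ _ W w∈
          f , f∈E , j = ∈-tabulate⁻ (λ y → any? (λ f → (f ∈? E) ×-dec joins? ends f v y)) w∈N
      in x∈⋃⁺ (edgesTo E v W) (⁅_⁆ ∘ opposite v) (∈-tabulate⁺ (edgeTo? E v W) (f∈E , w , w∈W , j))
              (subst (λ u → w ∈ ⁅ u ⁆) (sym (Joins⇒opposite≡ j)) (x∈⁅x⁆ w))

  endpoints : Fin e → Subset m
  endpoints f = ⁅ proj₁ (ends f) ⁆ ∪ ⁅ proj₂ (ends f) ⁆

  ∣endpoints∣≤2 : ∀ f → ∣ endpoints f ∣ ≤ 2
  ∣endpoints∣≤2 f = ≤-trans (∣p∪q∣≤∣p∣+∣q∣ ⁅ proj₁ (ends f) ⁆ _)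
                            (≤-reflexive (cong₂ _+_ (∣⁅x⁆∣≡1 (proj₁ (ends f))) (∣⁅x⁆∣≡1 (proj₂ (ends f)))))

  endpoints⊆ : ∀ {f W} → proj₁ (ends f) ∈ W → proj₂ (ends f) ∈ W → endpoints f ⊆ W
  endpoints⊆ u∈ w∈ = ∪-least (x∈p⇒⁅x⁆⊆p u∈) (x∈p⇒⁅x⁆⊆p w∈)

  ∈induced⁺ : ∀ {E K f} → f ∈ E → proj₁ (ends f) ∈ K → proj₂ (ends f) ∈ K → f ∈ induced ends E K
  ∈induced⁺ f∈E u∈K w∈K = ∈-tabulate⁺ _ (f∈E , u∈K , w∈K)

  ∈induced⁻ : ∀ {E K f} → f ∈ induced ends E K → f ∈ E × proj₁ (ends f) ∈ K × proj₂ (ends f) ∈ K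
  ∈induced⁻ = ∈-tabulate⁻ _

module ZeroExtensions {m e : ℕ} (ends : Fin e → Fin m × Fin m) (r : Subset e → ℕ) {d : ℕ}
                      (zero-extension : ZeroExtensionProperty ends r d) (D : Fin m → Subset e) where

  open Edges ends

  Attaches : Subset m → Fin m → Set
  Attaches W v = ∣ D v ∣ ≡ d × (∀ {f} → f ∈ D v → ∃ λ w → w ∈ W × Joins ends f v w)

  attaches-mono : ∀ {W W′ v} → W ⊆ W′ → Attaches W v → Attaches W′ v
  attaches-mono W⊆W′ (∣Dv∣ , joins) = ∣Dv∣ , λ f∈ → let w , w∈ , j = joins f∈ in w , W⊆W′ w∈ , j

  IndependentSubgraph : Subset m → Subset e → Set
  IndependentSubgraph W F = IsSubgraph ends W F × Independent r F

  attach : ∀ {W F v} → IndependentSubgraph W F → v ∉ W → Attaches W v →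
           IndependentSubgraph (W ∪ ⁅ v ⁆) (F ∪ D v) × ∣ F ∪ D v ∣ ≡ ∣ F ∣ + d
  attach {W} {F} {v} (sub , ind) v∉W (∣Dv∣ , joins) = (sub′ , ind′) , card
    where
    W⊆W+v = p⊆p∪q {p = W} ⁅ v ⁆
    v∈W+v = q⊆p∪q W ⁅ v ⁆ (x∈⁅x⁆ v)
    sub′ : IsSubgraph ends (W ∪ ⁅ v ⁆) (F ∪ D v)
    sub′ f f∈ with x∈p∪q⁻ F (D v) f∈
    ... | inj₁ f∈F  = let u∈ , w∈ = sub f f∈F in W⊆W+v u∈ , W⊆W+v w∈
    ... | inj₂ f∈Dv = let w , w∈ , j = joins f∈Dv in Joins⇒ends∈ j v∈W+v (W⊆W+v w∈)
    ind′ : Independent r (F ∪ D v)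
    ind′ = zero-extension W F _ _ sub sub′ ind
             (v , v∉W , refl , D v , ∣Dv∣ , (λ f f∈ → let w , w∈ , j = joins f∈ in w , W⊆W+v w∈ , j) , refl)
    F#Dv : Disjoint F (D v)
    F#Dv f∈F f∈Dv with joins f∈Dv
    ... | _ , _ , j with Joins⇒end≡ j | sub _ f∈F
    ...   | inj₁ u≡v | u∈ , _ = v∉W (subst (_∈ W) u≡v u∈)
    ...   | inj₂ w≡v | _ , w∈ = v∉W (subst (_∈ W) w≡v w∈)
    card : ∣ F ∪ D v ∣ ≡ ∣ F ∣ + d
    card = trans (disjoint⇒∣p∪q∣≡∣p∣+∣q∣ F (D v) F#Dv) (cong (∣ F ∣ +_) ∣Dv∣)

  Extension : Subset m → Subset e → Subset m → Set
  Extension W F L = IndependentSubgraph (W ∪ L) (F ∪ ⋃[ L ] D) × ∣ F ∪ ⋃[ L ] D ∣ ≡ ∣ F ∣ + d * ∣ L ∣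

  extension-from : ∀ {W F L V′ F′} → V′ ≡ W ∪ L → F′ ≡ F ∪ ⋃[ L ] D →
                   IndependentSubgraph V′ F′ → ∣ F′ ∣ ≡ ∣ F ∣ + d * ∣ L ∣ → Extension W F L
  extension-from refl refl isub card = isub , card

  extension : ∀ W F L → IndependentSubgraph W F → Disjoint L W → (∀ {v} → v ∈ L → Attaches W v) →
              Extension W F L
  extension W F L isub = go L (⊂-wellFounded L)
    where
    go : ∀ L → Acc _⊂_ L → Disjoint L W → (∀ {v} → v ∈ L → Attaches W v) → Extension W F L
    go L (acc rec) L#W attaches with nonempty? L
    ... | no L-empty rewrite Empty-unique L-empty =
      extension-from (sym (∪-identityʳ W)) (sym (trans (cong (F ∪_) (⋃-⊥ D)) (∪-identityʳ F))) isub (begin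
        ∣ F ∣                ≡⟨ +-identityʳ ∣ F ∣ ⟨
        ∣ F ∣ + 0            ≡⟨ cong (∣ F ∣ +_) (*-zeroʳ d) ⟨
        ∣ F ∣ + d * 0        ≡⟨ cong (λ k → ∣ F ∣ + d * k) (∣⊥∣≡0 m) ⟨
        ∣ F ∣ + d * ∣ ⊥ {m} ∣ ∎)
      where open ≡-Reasoning
    ... | yes (v , v∈L) =
      extension-from W′+v≡W∪L F′+Dv≡F∪⋃ isub″ (begin
        ∣ F′ ∪ D v ∣            ≡⟨ card″ ⟩
        ∣ F′ ∣ + d              ≡⟨ cong (_+ d) card′ ⟩
        ∣ F ∣ + d * ∣ L′ ∣ + d   ≡⟨ +-assoc ∣ F ∣ _ d ⟩
        ∣ F ∣ + (d * ∣ L′ ∣ + d) ≡⟨ cong (∣ F ∣ +_) (trans (+-comm _ d) (sym (*-suc d ∣ L′ ∣))) ⟩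
        ∣ F ∣ + d * suc ∣ L′ ∣   ≡⟨ cong (λ k → ∣ F ∣ + d * k) (x∈p⇒∣p∣≡1+∣p-x∣ v∈L) ⟨
        ∣ F ∣ + d * ∣ L ∣        ∎)
      where
      open ≡-Reasoning
      L′ = L - v
      L′⊆L = p─q⊆p L ⁅ v ⁆
      IH = go L′ (rec (x∈p⇒p-x⊂p v∈L)) (L#W ∘ L′⊆L) (attaches ∘ L′⊆L)
      F′ = F ∪ ⋃[ L′ ] D
      card′ = proj₂ IH
      v∉W∪L′ : v ∉ W ∪ L′
      v∉W∪L′ v∈ with x∈p∪q⁻ W L′ v∈
      ... | inj₁ v∈W  = L#W v∈L v∈W
      ... | inj₂ v∈L′ = proj₂ (x∈p─q⁻ L ⁅ v ⁆ v∈L′) (x∈⁅x⁆ v)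
      step = attach (proj₁ IH) v∉W∪L′ (attaches-mono (p⊆p∪q L′) (attaches v∈L))
      isub″ = proj₁ step
      card″ = proj₂ step
      W′+v≡W∪L : (W ∪ L′) ∪ ⁅ v ⁆ ≡ W ∪ L
      W′+v≡W∪L = trans (∪-assoc W L′ ⁅ v ⁆) (cong (W ∪_) (x∈p⇒p-x∪⁅x⁆≡p v∈L))
      F′+Dv≡F∪⋃ : F′ ∪ D v ≡ F ∪ ⋃[ L ] D
      F′+Dv≡F∪⋃ = begin
        (F ∪ ⋃[ L′ ] D) ∪ D v            ≡⟨ ∪-assoc F _ (D v) ⟩
        F ∪ (⋃[ L′ ] D ∪ D v)            ≡⟨ cong (λ S → F ∪ (⋃[ L′ ] D ∪ S)) (⋃-⁅⁆ v D) ⟨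
        F ∪ (⋃[ L′ ] D ∪ ⋃[ ⁅ v ⁆ ] D)   ≡⟨ cong (F ∪_) (⋃-∪ L′ ⁅ v ⁆ D) ⟨
        F ∪ ⋃[ L′ ∪ ⁅ v ⁆ ] D            ≡⟨ cong (λ S → F ∪ ⋃[ S ] D) (x∈p⇒p-x∪⁅x⁆≡p v∈L) ⟩
        F ∪ ⋃[ L ] D                     ∎

  extension-∪ : ∀ {W F L} L′ → Extension W F L → Disjoint L′ (W ∪ L) →
                (∀ {v} → v ∈ L′ → Attaches (W ∪ L) v) → Extension W F (L ∪ L′)
  extension-∪ {W} {F} {L} L′ (isub , card) L′#W∪L attaches =
    extension-from (∪-assoc W L L′) F″≡F∪⋃ isub′ (begin
      ∣ F′ ∪ ⋃[ L′ ] D ∣              ≡⟨ card′ ⟩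
      ∣ F′ ∣ + d * ∣ L′ ∣              ≡⟨ cong (_+ d * ∣ L′ ∣) card ⟩
      ∣ F ∣ + d * ∣ L ∣ + d * ∣ L′ ∣    ≡⟨ +-assoc ∣ F ∣ _ _ ⟩
      ∣ F ∣ + (d * ∣ L ∣ + d * ∣ L′ ∣)  ≡⟨ cong (∣ F ∣ +_) (*-distribˡ-+ d ∣ L ∣ ∣ L′ ∣) ⟨
      ∣ F ∣ + d * (∣ L ∣ + ∣ L′ ∣)      ≡⟨ cong (λ k → ∣ F ∣ + d * k) (disjoint⇒∣p∪q∣≡∣p∣+∣q∣ L L′ L#L′) ⟨
      ∣ F ∣ + d * ∣ L ∪ L′ ∣            ∎)
    where
    open ≡-Reasoning
    F′ = F ∪ ⋃[ L ] D
    L#L′ : Disjoint L L′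
    L#L′ v∈L v∈L′ = L′#W∪L v∈L′ (q⊆p∪q W L v∈L)
    next = extension (W ∪ L) F′ L′ isub L′#W∪L attaches
    isub′ = proj₁ next
    card′ = proj₂ next
    F″≡F∪⋃ : F′ ∪ ⋃[ L′ ] D ≡ F ∪ ⋃[ L ∪ L′ ] D
    F″≡F∪⋃ = trans (∪-assoc F _ _) (cong (F ∪_) (sym (⋃-∪ L L′ D)))

module Filtration {m e : ℕ} (ends : Fin e → Fin m × Fin m) (r : Subset e → ℕ) (isRank : IsMatroidRank r)
  (E : Subset e) (d : ℕ) (zero-extension : ZeroExtensionProperty ends r d)
  (t : ℕ) (X : ℕ → Subset m) (X-step : ∀ i → i < t → X i ⊆ X (suc i))
  (enough-neighbours : ∀ i → i < t → ∀ v → v ∈ X (suc i) → v ∉ X i → d ≤ ∣ nbhd ends E v ∩ X i ∣)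
  where

  open Edges ends
  open IsMatroidRank isRank
  open MatroidRank isRank

  V : Subset m
  V = X t

  X-mono : ∀ {i j} → i ≤ j → j ≤ t → X i ⊆ X j
  X-mono = go ∘ ≤⇒≤′
    where
    go : ∀ {i j} → i ≤′ j → j ≤ t → X i ⊆ X j
    go ≤′-refl        _   = ⊆-refl
    go (≤′-step i≤′j) j<t = X-step _ j<t ∘ go i≤′j (<⇒≤ j<t)

  X⊆V : ∀ {i} → i ≤ t → X i ⊆ V
  X⊆V i≤t = X-mono i≤t ≤-refl

  Enters : Fin m → ℕ → Set
  Enters v i = i < t × v ∈ X (suc i) × v ∉ X i

  enters-before : ∀ {v i j} → Enters v i → v ∈ X j → i < j
  enters-before {j = j} (i<t , _ , v∉Xi) v∈Xj with j ≤? _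
  ... | yes j≤i = ⊥-elim (v∉Xi (X-mono j≤i (<⇒≤ i<t) v∈Xj))
  ... | no  j≰i = ≰⇒> j≰i

  entry? : ∀ v → Dec (∃ λ (i : Fin t) → Enters v (toℕ i))
  entry? v = any? λ i → (yes (toℕ<n i)) ×-dec (v ∈? X (suc (toℕ i))) ×-dec ¬? (v ∈? X (toℕ i))

  down : Fin m → Subset e
  down v with entry? v
  ... | yes (i , _) = prefix d (edgesTo E v (X (toℕ i)))
  ... | no  _       = ⊥

  ∈down⁻ : ∀ {v f} → f ∈ down v → f ∈ E × ∃ λ i → Enters v i × ∃ λ w → w ∈ X i × Joins ends f v w
  ∈down⁻ {v} f∈ with entry? v
  ... | yes (i , entry) =
    let f∈E , w∈ = ∈-tabulate⁻ (edgeTo? E v (X (toℕ i))) (prefix⊆ d _ f∈) in f∈E , toℕ i , entry , w∈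
  ... | no  _ = ⊥-elim (∉⊥ f∈)

  ∣down∣≤d : ∀ v → ∣ down v ∣ ≤ d
  ∣down∣≤d v with entry? v
  ... | yes (i , _) = ≤-trans (≤-reflexive (∣prefix∣≡k⊓∣p∣ d (edgesTo E v (X (toℕ i))))) (m⊓n≤m d _)
  ... | no  _       = ≤-trans (≤-reflexive (∣⊥∣≡0 e)) z≤n

  ∣down∣≡d : ∀ {v i} → Enters v i → ∣ down v ∣ ≡ d
  ∣down∣≡d {v} {i} entry with entry? v
  ... | yes (k , k<t , v∈ , v∉) = trans (∣prefix∣≡k⊓∣p∣ d (edgesTo E v (X (toℕ k)))) (m≤n⇒m⊓n≡m
          (≤-trans (enough-neighbours (toℕ k) k<t v v∈ v∉) (∣nbhd∩W∣≤∣edgesTo∣ E v (X (toℕ k)))))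
  ... | no  never = ⊥-elim (never (fromℕ< i<t , subst (Enters v) (sym (toℕ-fromℕ< i<t)) entry))
    where i<t = proj₁ entry

  down-descends : ∀ {v j f} → j < t → v ∈ X (suc j) → f ∈ down v → ∃ λ w → w ∈ X j × Joins ends f v w
  down-descends j<t v∈ f∈ with ∈down⁻ f∈
  ... | _ , i , entry , w , w∈ , joins = w , X-mono (≤-pred (enters-before entry v∈)) (<⇒≤ j<t) w∈ , joins

  down-X₀ : ∀ {v f} → v ∈ X 0 → f ∉ down v
  down-X₀ v∈ f∈ with ∈down⁻ f∈
  ... | _ , _ , entry , _ = n≮0 (enters-before entry v∈)

  open ZeroExtensions ends r zero-extension down

  entering-attaches : ∀ {v i} → Enters v i → Attaches (X i) v
  entering-attaches entry@(i<t , v∈ , _) = ∣down∣≡d entry , down-descends i<t v∈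

  layered-extension : ∀ {K B} → X 0 ⊆ K → IndependentSubgraph K B → ∀ i → i ≤ t → Extension K B (X i ─ K)
  layered-extension {K} {B} X₀⊆K isub zero _ =
    extension K B (X 0 ─ K) isub (proj₂ ∘ x∈p─q⁻ (X 0) K) (⊥-elim ∘ X₀─K-empty)
    where
    X₀─K-empty : ∀ {v} → v ∉ X 0 ─ K
    X₀─K-empty v∈ = let v∈X₀ , v∉K = x∈p─q⁻ (X 0) K v∈ in v∉K (X₀⊆K v∈X₀)
  layered-extension {K} {B} X₀⊆K isub (suc i) i<t =
    subst (Extension K B) layers-merge
      (extension-∪ New (layered-extension X₀⊆K isub i (<⇒≤ i<t)) New#Old new-attaches)
    where
    Old = X i ─ K
    New = (X (suc i) ─ X i) ─ K
    New⁻ : ∀ {v} → v ∈ New → v ∈ X (suc i) × v ∉ X i × v ∉ K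
    New⁻ v∈ = let v∈Δ , v∉K = x∈p─q⁻ _ K v∈
                  v∈Xi+1 , v∉Xi = x∈p─q⁻ (X (suc i)) (X i) v∈Δ
              in v∈Xi+1 , v∉Xi , v∉K
    New#Old : Disjoint New (K ∪ Old)
    New#Old v∈New v∈ with New⁻ v∈New | x∈p∪q⁻ K Old v∈
    ... | _ , _ , v∉K  | inj₁ v∈K   = v∉K v∈K
    ... | _ , v∉Xi , _ | inj₂ v∈Old = v∉Xi (proj₁ (x∈p─q⁻ (X i) K v∈Old))
    new-attaches : ∀ {v} → v ∈ New → Attaches (K ∪ Old) v
    new-attaches v∈ = let v∈Xi+1 , v∉Xi , _ = New⁻ v∈ in
      attaches-mono (p⊆q∪[p─q] (X i) K) (entering-attaches (i<t , v∈Xi+1 , v∉Xi))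
    layers-merge : Old ∪ New ≡ X (suc i) ─ K
    layers-merge = ⊆-antisym (∪-least Old⊆ New⊆) merged
      where
      Old⊆ : Old ⊆ X (suc i) ─ K
      Old⊆ v∈ = let v∈Xi , v∉K = x∈p─q⁻ (X i) K v∈ in x∈p∧x∉q⇒x∈p─q (X-step i i<t v∈Xi) v∉K
      New⊆ : New ⊆ X (suc i) ─ K
      New⊆ v∈ = let v∈Xi+1 , _ , v∉K = New⁻ v∈ in x∈p∧x∉q⇒x∈p─q v∈Xi+1 v∉K
      merged : X (suc i) ─ K ⊆ Old ∪ New
      merged {v} v∈ with x∈p─q⁻ (X (suc i)) K v∈ | v ∈? X i
      ... | _ , v∉K      | yes v∈Xi = x∈p∪q⁺ (inj₁ (x∈p∧x∉q⇒x∈p─q v∈Xi v∉K))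
      ... | v∈Xi+1 , v∉K | no  v∉Xi = x∈p∪q⁺ (inj₂ (x∈p∧x∉q⇒x∈p─q (x∈p∧x∉q⇒x∈p─q v∈Xi+1 v∉Xi) v∉K))

  reach : ℕ → Fin m → Subset m
  reach zero    v = ⊥
  reach (suc j) v = ⁅ v ⁆ ∪ ⋃[ down v ] (reach j ∘ opposite v)

  ∣reach∣≤geometric : ∀ j v → ∣ reach j v ∣ ≤ geometric d j
  ∣reach∣≤geometric zero    v = ≤-reflexive (∣⊥∣≡0 m)
  ∣reach∣≤geometric (suc j) v = begin
    ∣ ⁅ v ⁆ ∪ ⋃[ down v ] (reach j ∘ opposite v) ∣       ≤⟨ ∣p∪q∣≤∣p∣+∣q∣ ⁅ v ⁆ _ ⟩
    ∣ ⁅ v ⁆ ∣ + ∣ ⋃[ down v ] (reach j ∘ opposite v) ∣   ≤⟨ +-mono-≤ (≤-reflexive (∣⁅x⁆∣≡1 v))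
                                                           (∣⋃∣≤∣p∣*c (down v) _ _ (λ {f} _ → ∣reach∣≤geometric j (opposite v f))) ⟩
    1 + ∣ down v ∣ * geometric d j                       ≤⟨ +-monoʳ-≤ 1 (*-monoˡ-≤ (geometric d j) (∣down∣≤d v)) ⟩
    1 + d * geometric d j                                ∎
    where open ≤-Reasoning

  down-child : ∀ {j v f} → j < t → v ∈ X (suc j) → f ∈ down v → opposite v f ∈ X j
  down-child j<t v∈ f∈ with down-descends j<t v∈ f∈
  ... | w , w∈ , joins = subst (_∈ X _) (sym (Joins⇒opposite≡ joins)) w∈

  reach⊆X : ∀ {j v} → j ≤ t → v ∈ X j → reach j v ⊆ X j
  reach⊆X {zero}  _   _  x∈ = ⊥-elim (∉⊥ x∈)
  reach⊆X {suc j} {v} j<t v∈ x∈ with x∈p∪q⁻ ⁅ v ⁆ _ x∈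
  ... | inj₁ x∈⁅v⁆ = subst (_∈ X (suc j)) (sym (x∈⁅y⁆⇒x≡y v x∈⁅v⁆)) v∈
  ... | inj₂ x∈⋃  = let f , f∈ , x∈reach = x∈⋃⁻ (down v) _ x∈⋃ in
    X-step j j<t (reach⊆X (<⇒≤ j<t) (down-child j<t v∈ f∈) x∈reach)

  reach-self : ∀ {j v} → v ∈ X j → v ∉ X 0 → v ∈ reach j v
  reach-self {zero}  v∈X₀ v∉X₀ = ⊥-elim (v∉X₀ v∈X₀)
  reach-self {suc j} {v} _ _ = x∈p∪q⁺ (inj₁ (x∈⁅x⁆ v))

  reach-child⊆ : ∀ {j v f} → f ∈ down v → reach j (opposite v f) ⊆ reach (suc j) v
  reach-child⊆ {v = v} f∈ = q⊆p∪q ⁅ v ⁆ _ ∘ x∈⋃⁺ (down v) _ f∈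

  reach-closed : ∀ {j v x f} → j ≤ t → v ∈ X j → x ∈ reach j v → f ∈ down x →
                 opposite x f ∈ X 0 ∪ reach j v
  reach-closed {zero} _ _ x∈ _ = ⊥-elim (∉⊥ x∈)
  reach-closed {suc j} {v} {x} {f} j<t v∈ x∈ f∈ with x∈p∪q⁻ ⁅ v ⁆ _ x∈
  ... | inj₁ x∈⁅v⁆ rewrite x∈⁅y⁆⇒x≡y v x∈⁅v⁆ with opposite v f ∈? X 0
  ...   | yes w∈X₀ = x∈p∪q⁺ (inj₁ w∈X₀)
  ...   | no  w∉X₀ = q⊆p∪q (X 0) _ (reach-child⊆ {j} f∈ (reach-self (down-child j<t v∈ f∈) w∉X₀))
  reach-closed {suc j} {v} {x} {f} j<t v∈ x∈ f∈ | inj₂ x∈⋃ with x∈⋃⁻ (down v) _ x∈⋃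
  ... | g , g∈ , x∈reach = ∪-least (p⊆p∪q _) (q⊆p∪q (X 0) _ ∘ reach-child⊆ {j} g∈)
                                   (reach-closed (<⇒≤ j<t) (down-child j<t v∈ g∈) x∈reach f∈)

  hull : Subset m → Subset m
  hull S = X 0 ∪ ⋃[ S ] (reach t)

  module _ {S : Subset m} (S⊆V : S ⊆ V) where

    X₀⊆hull : X 0 ⊆ hull S
    X₀⊆hull = p⊆p∪q _

    hull⊆V : hull S ⊆ V
    hull⊆V = ∪-least (X⊆V z≤n) (⋃-least S λ s∈ → reach⊆X ≤-refl (S⊆V s∈))

    S⊆hull : S ⊆ hull S
    S⊆hull {s} s∈ with s ∈? X 0
    ... | yes s∈X₀ = X₀⊆hull s∈X₀
    ... | no  s∉X₀ = q⊆p∪q (X 0) _ (x∈⋃⁺ S (reach t) s∈ (reach-self (S⊆V s∈) s∉X₀))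

    hull-closed : ∀ {v f} → v ∈ hull S → f ∈ down v → opposite v f ∈ hull S
    hull-closed {v} v∈ f∈ with x∈p∪q⁻ (X 0) _ v∈
    ... | inj₁ v∈X₀ = ⊥-elim (down-X₀ v∈X₀ f∈)
    ... | inj₂ v∈⋃ = let s , s∈ , v∈reach = x∈⋃⁻ S (reach t) v∈⋃ in
      ∪-least (p⊆p∪q _) (q⊆p∪q (X 0) _ ∘ x∈⋃⁺ S (reach t) s∈) (reach-closed ≤-refl (S⊆V s∈) v∈reach f∈)

  ∣hull∣≤ : ∀ S → ∣ hull S ∣ ≤ ∣ X 0 ∣ + ∣ S ∣ * geometric d t
  ∣hull∣≤ S = ≤-trans (∣p∪q∣≤∣p∣+∣q∣ (X 0) _)
                      (+-monoʳ-≤ ∣ X 0 ∣ (∣⋃∣≤∣p∣*c S (reach t) _ λ {s} _ → ∣reach∣≤geometric t s))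

  lowest-escape : ∀ {K′} → X 0 ⊆ K′ → ∀ {i y} → i ≤ t → y ∈ X i → y ∉ K′ →
                  ∃ λ j → ∃ λ x → Enters x j × x ∉ K′ × X j ⊆ K′
  lowest-escape X₀⊆K′ {zero}  _ y∈X₀ y∉K′ = ⊥-elim (y∉K′ (X₀⊆K′ y∈X₀))
  lowest-escape {K′} X₀⊆K′ {suc i} {y} i<t y∈ y∉K′ with any? (λ z → (z ∈? X i) ×-dec ¬? (z ∈? K′))
  ... | yes (z , z∈Xi , z∉K′) = lowest-escape X₀⊆K′ (<⇒≤ i<t) z∈Xi z∉K′
  ... | no  none = i , y , (i<t , y∈ , y∉K′ ∘ Xi⊆K′) , y∉K′ , Xi⊆K′
    where
    Xi⊆K′ : X i ⊆ K′
    Xi⊆K′ {z} z∈Xi with z ∈? K′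
    ... | yes z∈K′ = z∈K′
    ... | no  z∉K′ = ⊥-elim (none (z , z∈Xi , z∉K′))

  seed-growth : ∀ {K′} → X 0 ⊆ K′ → K′ ⊂ V →
                ∃ λ x → x ∈ V × x ∉ K′ × d ≤ ∣ (K′ ∪ ⁅ x ⁆) ∩ nbhd ends E x ∣
  seed-growth {K′} X₀⊆K′ (_ , y , y∈V , y∉K′) with lowest-escape X₀⊆K′ ≤-refl y∈V y∉K′
  ... | j , x , (j<t , x∈ , x∉) , x∉K′ , Xj⊆K′ =
    x , X⊆V j<t x∈ , x∉K′ , ≤-trans (enough-neighbours j j<t x x∈ x∉) (p⊆q⇒∣p∣≤∣q∣ N∩Xj⊆)
    where
    N∩Xj⊆ : nbhd ends E x ∩ X j ⊆ (K′ ∪ ⁅ x ⁆) ∩ nbhd ends E x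
    N∩Xj⊆ z∈ = let z∈N , z∈Xj = x∈p∩q⁻ _ (X j) z∈ in x∈p∩q⁺ (p⊆p∪q ⁅ x ⁆ (Xj⊆K′ z∈Xj) , z∈N)

  down⊆E : ∀ v → down v ⊆ E
  down⊆E v = proj₁ ∘ ∈down⁻

  induced-basis : ∀ K → ∃ λ B → B ⊆ E × IndependentSubgraph K B × r (induced ends E K) ≡ ∣ B ∣
  induced-basis K with basis-extension (induced ends E K) ⊥ (⊆-min _) independent-⊥
  ... | B , _ , basis@(B⊆EK , indB , _) =
    B , proj₁ ∘ ∈induced⁻ ∘ B⊆EK , ((λ f f∈ → proj₂ (∈induced⁻ (B⊆EK f∈))) , indB) , basis-rank basis

  seed-rank : ∀ {K} → X 0 ⊆ K → r E ≤ r (induced ends E K ∪ ⋃[ V ─ K ] down) →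
              r E ≡ r (induced ends E K) + d * ∣ V ─ K ∣
  seed-rank {K} X₀⊆K rE≤ = ≤-antisym upper lower
    where
    open ≤-Reasoning
    EK = induced ends E K
    U = ⋃[ V ─ K ] down
    upper : r E ≤ r EK + d * ∣ V ─ K ∣
    upper = begin
      r E                      ≤⟨ rE≤ ⟩
      r (EK ∪ U)               ≤⟨ r-subadditive EK U ⟩
      r EK + r U               ≤⟨ +-monoʳ-≤ (r EK) (r-bounded U) ⟩
      r EK + ∣ U ∣              ≤⟨ +-monoʳ-≤ (r EK) (∣⋃∣≤∣p∣*c (V ─ K) down d λ {v} _ → ∣down∣≤d v) ⟩
      r EK + ∣ V ─ K ∣ * d      ≡⟨ cong (r EK +_) (*-comm ∣ V ─ K ∣ d) ⟩
      r EK + d * ∣ V ─ K ∣      ∎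
    lower : r EK + d * ∣ V ─ K ∣ ≤ r E
    lower with induced-basis K
    ... | B , B⊆E , isub , rEK≡ with layered-extension X₀⊆K isub t ≤-refl
    ... | (_ , indF) , ∣F∣ = begin
      r EK + d * ∣ V ─ K ∣      ≡⟨ cong (_+ d * ∣ V ─ K ∣) rEK≡ ⟩
      ∣ B ∣ + d * ∣ V ─ K ∣     ≡⟨ ∣F∣ ⟨
      ∣ B ∪ U ∣                ≡⟨ indF ⟨
      r (B ∪ U)                ≤⟨ r-monotone _ _ (∪-least B⊆E (⋃-least (V ─ K) λ _ → down⊆E _)) ⟩
      r E                      ∎

  module _ (sub : IsSubgraph ends V E) where

    F₀ : Subset e
    F₀ = ⋃[ V ─ X 0 ] down

    F₀-independent : Independent r F₀ × ∣ F₀ ∣ ≡ d * ∣ V ─ X 0 ∣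
    F₀-independent with layered-extension ⊆-refl ((λ _ → ⊥-elim ∘ ∉⊥) , independent-⊥) t ≤-refl
    ... | (_ , ind) , card =
      subst (Independent r) (∪-identityˡ F₀) ind ,
      trans (cong ∣_∣ (sym (∪-identityˡ F₀))) (trans card (cong (_+ d * ∣ V ─ X 0 ∣) (∣⊥∣≡0 e)))

    surplus-bound : r ⊤ ≤ d * ∣ V ∣ → ∀ {Bas} → F₀ ⊆ Bas → Independent r Bas → ∣ Bas ─ F₀ ∣ ≤ d * ∣ X 0 ∣
    surplus-bound rank-bound {Bas} F₀⊆Bas indBas = +-cancelˡ-≤ ∣ F₀ ∣ _ _ (begin
      ∣ F₀ ∣ + ∣ Bas ─ F₀ ∣           ≡⟨ ∣p∣≡∣q∣+∣p─q∣ Bas F₀ F₀⊆Bas ⟨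
      ∣ Bas ∣                        ≡⟨ indBas ⟨
      r Bas                          ≤⟨ r-monotone _ _ ⊆⊤ ⟩
      r ⊤                            ≤⟨ rank-bound ⟩
      d * ∣ V ∣                       ≡⟨ cong (d *_) (∣p∣≡∣q∣+∣p─q∣ V (X 0) (X⊆V z≤n)) ⟩
      d * (∣ X 0 ∣ + ∣ V ─ X 0 ∣)      ≡⟨ *-distribˡ-+ d ∣ X 0 ∣ _ ⟩
      d * ∣ X 0 ∣ + d * ∣ V ─ X 0 ∣    ≡⟨ cong (d * ∣ X 0 ∣ +_) (proj₂ F₀-independent) ⟨
      d * ∣ X 0 ∣ + ∣ F₀ ∣             ≡⟨ +-comm _ ∣ F₀ ∣ ⟩
      ∣ F₀ ∣ + d * ∣ X 0 ∣             ∎)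
      where open ≤-Reasoning

    module _ {Bas : Subset e} (Bas⊆E : Bas ⊆ E) where

      surplus-ends : Subset m
      surplus-ends = ⋃[ Bas ─ F₀ ] endpoints

      surplus-ends⊆V : surplus-ends ⊆ V
      surplus-ends⊆V = ⋃-least (Bas ─ F₀) λ {f} f∈ →
        let u∈V , w∈V = sub f (Bas⊆E (p─q⊆p Bas F₀ f∈)) in endpoints⊆ u∈V w∈V

      K : Subset m
      K = hull surplus-ends

      basis-covered : Bas ⊆ induced ends E K ∪ ⋃[ V ─ K ] down
      basis-covered {f} f∈Bas with f ∈? F₀
      ... | no f∉F₀ = p⊆p∪q _ (∈induced⁺ (Bas⊆E f∈Bas) (ends⊆K (p⊆p∪q _ (x∈⁅x⁆ _))) (ends⊆K (q⊆p∪q _ _ (x∈⁅x⁆ _))))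
        where
        ends⊆K : endpoints f ⊆ K
        ends⊆K = S⊆hull surplus-ends⊆V ∘ x∈⋃⁺ (Bas ─ F₀) endpoints (x∈p∧x∉q⇒x∈p─q f∈Bas f∉F₀)
      ... | yes f∈F₀ with x∈⋃⁻ (V ─ X 0) down f∈F₀
      ...   | v , v∈ , f∈down with v ∈? K
      ...     | no v∉K = q⊆p∪q _ _ (x∈⋃⁺ (V ─ K) down (x∈p∧x∉q⇒x∈p─q (proj₁ (x∈p─q⁻ V (X 0) v∈)) v∉K) f∈down)
      ...     | yes v∈K with ∈down⁻ f∈down
      ...       | f∈E , _ , _ , w , _ , joins =
        let w∈K = subst (_∈ K) (Joins⇒opposite≡ joins) (hull-closed surplus-ends⊆V v∈K f∈down)
            u∈K , w∈K = Joins⇒ends∈ joins v∈K w∈K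
        in p⊆p∪q _ (∈induced⁺ f∈E u∈K w∈K)

    bounded-seed : r ⊤ ≤ d * ∣ V ∣ →
                   ∃ λ K → IsSeed ends r d V E K × ∣ K ∣ ≤ ∣ X 0 ∣ + d * ∣ X 0 ∣ * 2 * geometric d t
    bounded-seed rank-bound with basis-extension E F₀ (⋃-least (V ─ X 0) λ {v} _ → down⊆E v) (proj₁ F₀-independent)
    ... | Bas , F₀⊆Bas , Bas⊆E , indBas , rE≤rBas =
      K Bas⊆E , (hull⊆V ends⊆V , rank-equation , growth) , size
      where
      ends⊆V = surplus-ends⊆V Bas⊆E
      X₀⊆K = X₀⊆hull ends⊆V
      rank-equation : r E ≡ r (induced ends E (K Bas⊆E)) + d * ∣ V ─ K Bas⊆E ∣
      rank-equation = seed-rank X₀⊆K (≤-trans rE≤rBas (r-monotone _ _ (basis-covered Bas⊆E)))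
      growth : ∀ K′ → K Bas⊆E ⊆ K′ → K′ ⊂ V →
               ∃ λ x → x ∈ V × x ∉ K′ × d ≤ ∣ (K′ ∪ ⁅ x ⁆) ∩ nbhd ends E x ∣
      growth K′ K⊆K′ = seed-growth (K⊆K′ ∘ X₀⊆K)
      ∣ends∣≤ : ∣ surplus-ends Bas⊆E ∣ ≤ d * ∣ X 0 ∣ * 2
      ∣ends∣≤ = ≤-trans (∣⋃∣≤∣p∣*c (Bas ─ F₀) endpoints 2 λ {f} _ → ∣endpoints∣≤2 f)
                        (*-monoˡ-≤ 2 (surplus-bound rank-bound F₀⊆Bas indBas))
      size : ∣ K Bas⊆E ∣ ≤ ∣ X 0 ∣ + d * ∣ X 0 ∣ * 2 * geometric d t
      size = ≤-trans (∣hull∣≤ (surplus-ends Bas⊆E)) (+-monoʳ-≤ ∣ X 0 ∣ (*-monoˡ-≤ (geometric d t) ∣ends∣≤))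

lemma3p2 : (m e : ℕ) (ends : Fin e → Fin m × Fin m) → Semisimple ends →
    (r : Subset e → ℕ) → IsMatroidRank r →
    (V : Subset m) (E : Subset e) → IsSubgraph ends V E →
    (d : ℕ) → 2 ≤ d →
    ZeroExtensionProperty ends r d →
    r ⊤ ≤ d * ∣ V ∣ →
    (t : ℕ) (X : ℕ → Subset m) →
    (∀ i → i < t → X i ⊆ X (suc i)) →
    X t ≡ V →
    (∀ i → i < t → ∀ v → v ∈ X (suc i) → v ∉ X i →
       d ≤ ∣ nbhd ends E v ∩ X i ∣) →
    Σ (Subset m) λ K → IsSeed ends r d V E K ×
      (d ∸ 1) * ∣ K ∣ ≤ 2 * ∣ X 0 ∣ * d ^ (t + 1)
lemma3p2 m e ends _ r isRank .(X t) E sub (suc d′) (s≤s _) zero-extension rank-bound t X X-step refl enough-neighbours =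
  map₂ (λ {K} → map₂ (seed-size-arithmetic d′ t ∣ X 0 ∣ ∣ K ∣))
       (Filtration.bounded-seed ends r isRank E (suc d′) zero-extension t X X-step enough-neighbours sub rank-bound)
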